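{- Let $P$ and $Q$ be $\pi$-calculus processes (possibly containing replication). If $P \sim Q$ (open bisimilarity), then for every $\mathcal{OM}$ formula $\phi$ we have $P \vDash \phi$ if and only if $Q \vDash \phi$.
   Context: Names $a,b,x,y,z,\dots$ range over a countably infinite set. Actions: $\pi ::= \tau \mid \overline{x}z \mid \overline{x}(z) \mid x(z)$ (silent, free output, bound output, input). Processes: $P ::= 0 \mid \nu x.P \mid \pi.P \mid [x=y]P \mid P \| P \mid P + P \mid\ !P$. The binders $\nu x.P$, $z(x).P$, $\overline{z}(x).P$ bind $x$ in $P$; processes are taken up to $\alpha$-conversion; $\mathrm{fv}(E)$ denotes free names. Set $\mathrm{n}(x(y))=\mathrm{n}(\overline{x}(y))=\mathrm{n}(\overline{x}y)=\{x,y\}$, $\mathrm{bn}(x(y))=\mathrm{bn}(\overline{x}(y))=\{y\}$, $\mathrm{n}(\tau)=\mathrm{bn}(\tau)=\mathrm{bn}(\overline{x}y)=\emptyset$. The (late) labelled transition relation $P \xrightarrow{\pi} Q$ is the least relation closed under: $\pi.P \xrightarrow{\pi} P$; if $P\xrightarrow{\overline{x}z}Q$ and $x\neq z$ then $\nu z.P \xrightarrow{\overline{x}(z)} Q$; if $P\xrightarrow{\pi}R$ then $P+Q\xrightarrow{\pi}R$ and $Q+P\xrightarrow{\pi}R$; if $P\xrightarrow{\pi}R$ then $[x=x]P\xrightarrow{\pi}R$; if $P\xrightarrow{\pi}Q$ and $x\notin\mathrm{n}(\pi)$ then $\nu x.P\xrightarrow{\pi}\nu x.Q$; if $P\xrightarrow{\pi}Q$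 and the names in $\mathrm{bn}(\pi)$ are fresh for $R$ then $P\|R\xrightarrow{\pi}Q\|R$ and $R\|P\xrightarrow{\pi}R\|Q$; if $P\xrightarrow{\overline{x}(z)}P'$ and $Q\xrightarrow{x(z)}Q'$ then $P\|Q\xrightarrow{\tau}\nu z.(P'\|Q')$ and $Q\|P\xrightarrow{\tau}\nu z.(Q'\|P')$; if $P\xrightarrow{\overline{x}y}P'$ and $Q\xrightarrow{x(z)}Q'$ then $P\|Q\xrightarrow{\tau}P'\|Q'\{y/z\}$ and $Q\|P\xrightarrow{\tau}Q'\{y/z\}\|P'$; if $P\|!P\xrightarrow{\pi}Q$ then $!P\xrightarrow{\pi}Q$. Substitutions $\sigma$ are maps from names to names, applied capture-avoidingly. A history is a dot-separated list of names each annotated $o$ (private output) or $i$ (input), e.g. $x^i\cdot y^o\cdot z^i$. A substitution $\sigma$ respects history $h$ if for all $h',h''$ with $h=h'\cdot x^o\cdot h''$ we have $x\sigma=x$ and $y\sigma\neq x$ for all $y\in\mathrm{fv}(h')$. Open bisimulation: a symmetric relation $\mathcal{R}$ on processes indexed by histories such that whenever $P\,\mathcal{R}^h\,Q$: (1) for all $\sigma$ respecting $h$, $P\sigma\,\mathcal{R}^{h\sigma}\,Q\sigma$; (2) if $P\xrightarrow{\alpha}P'$ with $\alpha$ being $\tau$ or $\overline{a}b$, there is $Q'$ with $Q\xrightarrow{\alpha}Q'$ and $P'\,\mathcal{R}^h\,Q'$; (3) if $P\xrightarrow{\overline{a}(x)}P'$ with $x$ fresh for $P,Q,h$, there is $Q'$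 with $Q\xrightarrow{\overline{a}(x)}Q'$ and $P'\,\mathcal{R}^{h\cdot x^o}\,Q'$; (4) if $P\xrightarrow{a(x)}P'$ with $x$ fresh for $P,Q,h$, there is $Q'$ with $Q\xrightarrow{a(x)}Q'$ and $P'\,\mathcal{R}^{h\cdot x^i}\,Q'$. $P\sim Q$ iff some open bisimulation has $P\,\mathcal{R}^{x_0^i\cdots x_n^i}\,Q$ where $\mathrm{fv}(P)\cup\mathrm{fv}(Q)\subseteq\{x_0,\dots,x_n\}$. $\mathcal{OM}$ formulae: $\phi ::= \mathtt{tt}\mid\mathtt{ff}\mid\phi\wedge\phi\mid\phi\vee\phi\mid\phi\supset\phi\mid x=y\mid\langle\pi\rangle\phi\mid[\pi]\phi$, where in $\langle\overline{a}(z)\rangle\phi,[\overline{a}(z)]\phi,\langle a(z)\rangle\phi,[a(z)]\phi$ the name $z$ is bound in $\phi$. Relation $P\vDash^h\phi$ (with $z$ below fresh for $P,h,\sigma$; $\alpha$ ranging over $\tau$ and $\overline{a}b$): $P\vDash^h\mathtt{tt}$ and $P\vDash^h x=x$ always; $P\vDash^h\mathtt{ff}$ never, and $P\vDash^h x=y$ never for distinct names $x,y$; $\wedge,\vee$ pointwise; $P\vDash^h\phi_1\supset\phi_2$ iff for all $\sigma$ respecting $h$, $P\sigma\vDash^{h\sigma}\phi_1\sigma$ implies $P\sigma\vDash^{h\sigma}\phi_2\sigma$; $P\vDash^h\langle\alpha\rangle\phi$ iff $\exists Q$, $P\xrightarrow{\alpha}Q$ and $Q\vDash^h\phi$; $P\vDash^h\langle\overline{a}(z)\rangle\phi$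 iff $\exists Q$, $P\xrightarrow{\overline{a}(z)}Q$ and $Q\vDash^{h\cdot z^o}\phi$; $P\vDash^h\langle a(z)\rangle\phi$ iff $\exists Q$, $P\xrightarrow{a(z)}Q$ and $Q\vDash^{h\cdot z^i}\phi$; $P\vDash^h[\alpha]\phi$ iff for all $\sigma$ respecting $h$ and all $Q$, $P\sigma\xrightarrow{\alpha\sigma}Q$ implies $Q\vDash^{h\sigma}\phi\sigma$; $P\vDash^h[\overline{a}(z)]\phi$ iff for all $\sigma$ respecting $h$ and all $Q$, $P\sigma\xrightarrow{\overline{a\sigma}(z)}Q$ implies $Q\vDash^{h\sigma\cdot z^o}\phi\sigma$; $P\vDash^h[a(z)]\phi$ iff for all $\sigma$ respecting $h$ and all $Q$, $P\sigma\xrightarrow{a\sigma(z)}Q$ implies $Q\vDash^{h\sigma\cdot z^i}\phi\sigma$. Finally $P\vDash\phi$ iff $P\vDash^{x_0^i\cdots x_n^i}\phi$ where $\mathrm{fv}(P)\cup\mathrm{fv}(\phi)\subseteq\{x_0,\dots,x_n\}$. -}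

module Defs where

open import Data.Nat using (ℕ; zero; suc; _≟_)
open import Data.Fin using (Fin; zero; suc)
open import Data.List using (List; []; _∷_; _++_; map; [_]; _∷ʳ_)
open import Data.List.Membership.Propositional using (_∈_; _∉_)
open import Data.List.Relation.Binary.Subset.Propositional using (_⊆_)
open import Data.Maybe using (Maybe; just; nothing; maybe)
open import Data.Product using (Σ; ∃; _×_; _,_; proj₁; proj₂)
open import Data.Sum using (_⊎_)
open import Data.Unit using (⊤)
open import Data.Empty using (⊥)
open import Data.Bool using (if_then_else_)
open import Function using (_∘_; id)
open import Relation.Nullary using (does)
open import Relation.Binary.PropositionalEquality using (_≡_; _≢_)

-- Names and (locally nameless, well-scoped) name occurrences.
-- Free names are natural numbers; bound names are de Bruijn indices
-- (Fin n), so alpha-equivalent processes are syntactically equal.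

Name : Set
Name = ℕ

data Nm (n : ℕ) : Set where
  fr : Name → Nm n
  bd : Fin n → Nm n

weakenNm : ∀ {n} → Nm n → Nm (suc n)
weakenNm (fr x) = fr x
weakenNm (bd i) = bd (suc i)

liftNm : ∀ {m n} → (Nm m → Nm n) → Nm (suc m) → Nm (suc n)
liftNm f (fr x)       = weakenNm (f (fr x))
liftNm f (bd zero)    = bd zero
liftNm f (bd (suc i)) = weakenNm (f (bd i))

val : Nm 0 → Name
val (fr x) = x
val (bd ())

-- Processes.  nu, bout and inp bind index 0 in their body.
--   nil          0
--   nu P         νx.P
--   tauP P       τ.P
--   outP a b P   ā b.P
--   boutP a P    ā(z).P
--   inpP a P     a(z).P
--   match a b P  [a=b]P
--   par P Q      P ‖ Q
--   sum P Q      P + Q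
--   bang P       !P

data Proc (n : ℕ) : Set where
  nil   : Proc n
  nu    : Proc (suc n) → Proc n
  tauP  : Proc n → Proc n
  outP  : Nm n → Nm n → Proc n → Proc n
  boutP : Nm n → Proc (suc n) → Proc n
  inpP  : Nm n → Proc (suc n) → Proc n
  match : Nm n → Nm n → Proc n → Proc n
  par   : Proc n → Proc n → Proc n
  sum   : Proc n → Proc n → Proc n
  bang  : Proc n → Proc n

mapP : ∀ {m n} → (Nm m → Nm n) → Proc m → Proc n
mapP f nil           = nil
mapP f (nu P)        = nu (mapP (liftNm f) P)
mapP f (tauP P)      = tauP (mapP f P)
mapP f (outP a b P)  = outP (f a) (f b) (mapP f P)
mapP f (boutP a P)   = boutP (f a) (mapP (liftNm f) P)
mapP f (inpP a P)    = inpP (f a) (mapP (liftNm f) P)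
mapP f (match a b P) = match (f a) (f b) (mapP f P)
mapP f (par P Q)     = par (mapP f P) (mapP f Q)
mapP f (sum P Q)     = sum (mapP f P) (mapP f Q)
mapP f (bang P)      = bang (mapP f P)

fvNm : ∀ {n} → Nm n → List Name
fvNm (fr x) = [ x ]
fvNm (bd i) = []

fvP : ∀ {n} → Proc n → List Name
fvP nil           = []
fvP (nu P)        = fvP P
fvP (tauP P)      = fvP P
fvP (outP a b P)  = fvNm a ++ fvNm b ++ fvP P
fvP (boutP a P)   = fvNm a ++ fvP P
fvP (inpP a P)    = fvNm a ++ fvP P
fvP (match a b P) = fvNm a ++ fvNm b ++ fvP P
fvP (par P Q)     = fvP P ++ fvP Q
fvP (sum P Q)     = fvP P ++ fvP Q
fvP (bang P)      = fvP P

openNm : ∀ {n} → Name → Nm (suc n) → Nm n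
openNm z (fr x)       = fr x
openNm z (bd zero)    = fr z
openNm z (bd (suc i)) = bd i

openP : ∀ {n} → Proc (suc n) → Name → Proc n
openP P z = mapP (openNm z) P

closeNm : ∀ {n} → Name → Nm n → Nm (suc n)
closeNm z (fr x) = if does (x ≟ z) then bd zero else fr x
closeNm z (bd i) = bd (suc i)

closeP : ∀ {n} → Name → Proc n → Proc (suc n)
closeP z P = mapP (closeNm z) P

-- Substitutions: arbitrary maps from names to names, acting on free names
-- (capture-avoiding by construction).
Subst : Set
Subst = Name → Name

substNm : ∀ {n} → Subst → Nm n → Nm n
substNm σ (fr x) = fr (σ x)
substNm σ (bd i) = bd i

substP : ∀ {n} → Subst → Proc n → Proc n
substP σ P = mapP (substNm σ) P

_/_ : Name → Name → Subst
(y / z) x = if does (x ≟ z) then y else x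

-- Actions (labels):  τ,  x̄z (free output),  x̄(z) (bound output),  x(z) (input)

data Act : Set where
  τ  : Act
  fo : Name → Name → Act
  bo : Name → Name → Act
  ip : Name → Name → Act

nA : Act → List Name
nA τ        = []
nA (fo x y) = x ∷ y ∷ []
nA (bo x y) = x ∷ y ∷ []
nA (ip x y) = x ∷ y ∷ []

bnA : Act → List Name
bnA τ        = []
bnA (fo x y) = []
bnA (bo x y) = [ y ]
bnA (ip x y) = [ y ]

substA : Subst → Act → Act
substA σ τ        = τ
substA σ (fo x y) = fo (σ x) (σ y)
substA σ (bo x y) = bo (σ x) y
substA σ (ip x y) = ip (σ x) y

BnFresh : Act → Proc 0 → Set
BnFresh π R = ∀ {z} → z ∈ bnA π → z ∉ fvP R

-- Late labelled transition relation on closed-scope processes.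
-- A binder (prefix or restriction) is instantiated by any name that is
-- not free in the process carrying the binder (alpha-conversion).

infix 4 _—[_]→_

data _—[_]→_ : Proc 0 → Act → Proc 0 → Set where
  pre-τ    : ∀ {P} → tauP P —[ τ ]→ P
  pre-out  : ∀ {a b P} → outP a b P —[ fo (val a) (val b) ]→ P
  pre-bout : ∀ {a P z} → z ∉ fvP (boutP a P) →
             boutP a P —[ bo (val a) z ]→ openP P z
  pre-in   : ∀ {a P z} → z ∉ fvP (inpP a P) →
             inpP a P —[ ip (val a) z ]→ openP P z
  opn      : ∀ {P x z Q} → z ∉ fvP (nu P) → x ≢ z →
             openP P z —[ fo x z ]→ Q → nu P —[ bo x z ]→ Q
  sumL     : ∀ {P Q R π} → P —[ π ]→ R → sum P Q —[ π ]→ R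
  sumR     : ∀ {P Q R π} → P —[ π ]→ R → sum Q P —[ π ]→ R
  mat      : ∀ {a b P R π} → val a ≡ val b → P —[ π ]→ R →
             match a b P —[ π ]→ R
  res      : ∀ {P Q z π} → z ∉ fvP (nu P) → z ∉ nA π →
             openP P z —[ π ]→ Q → nu P —[ π ]→ nu (closeP z Q)
  parL     : ∀ {P Q R π} → P —[ π ]→ Q → BnFresh π R →
             par P R —[ π ]→ par Q R
  parR     : ∀ {P Q R π} → P —[ π ]→ Q → BnFresh π R →
             par R P —[ π ]→ par R Q
  closeL   : ∀ {P P' Q Q' x z} → P —[ bo x z ]→ P' → Q —[ ip x z ]→ Q' →
             par P Q —[ τ ]→ nu (closeP z (par P' Q'))
  closeR   : ∀ {P P' Q Q' x z} → P —[ bo x z ]→ P' → Q —[ ip x z ]→ Q' →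
             par Q P —[ τ ]→ nu (closeP z (par Q' P'))
  commL    : ∀ {P P' Q Q' x y z} → P —[ fo x y ]→ P' → Q —[ ip x z ]→ Q' →
             par P Q —[ τ ]→ par P' (substP (y / z) Q')
  commR    : ∀ {P P' Q Q' x y z} → P —[ fo x y ]→ P' → Q —[ ip x z ]→ Q' →
             par Q P —[ τ ]→ par (substP (y / z) Q') P'
  rep      : ∀ {P Q π} → par P (bang P) —[ π ]→ Q → bang P —[ π ]→ Q

-- Histories, written left to right (h · x^o is  h ∷ʳ (x , tO)).

data Tag : Set where
  tO : Tag
  tI : Tag

History : Set
History = List (Name × Tag)

names : History → List Name
names = map proj₁

substH : Subst → History → History
substH σ = map (λ p → σ (proj₁ p) , proj₂ p)

Respects : Subst → History → Set
Respects σ h = ∀ h' x h'' → h ≡ h' ++ ((x , tO) ∷ h'') →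
               (σ x ≡ x) × (∀ y → y ∈ names h' → σ y ≢ x)

inputs : List Name → History
inputs = map (λ x → x , tI)

record IsOpenBisim (R : History → Proc 0 → Proc 0 → Set) : Set where
  field
    symm   : ∀ {h P Q} → R h P Q → R h Q P
    substR : ∀ {h P Q} → R h P Q → ∀ σ → Respects σ h →
             R (substH σ h) (substP σ P) (substP σ Q)
    stepτ  : ∀ {h P Q P'} → R h P Q → P —[ τ ]→ P' →
             ∃ λ Q' → (Q —[ τ ]→ Q') × R h P' Q'
    stepFo : ∀ {h P Q P' a b} → R h P Q → P —[ fo a b ]→ P' →
             ∃ λ Q' → (Q —[ fo a b ]→ Q') × R h P' Q'
    stepBo : ∀ {h P Q P' a x} → R h P Q →
             x ∉ fvP P → x ∉ fvP Q → x ∉ names h →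
             P —[ bo a x ]→ P' →
             ∃ λ Q' → (Q —[ bo a x ]→ Q') × R (h ∷ʳ (x , tO)) P' Q'
    stepIp : ∀ {h P Q P' a x} → R h P Q →
             x ∉ fvP P → x ∉ fvP Q → x ∉ names h →
             P —[ ip a x ]→ P' →
             ∃ λ Q' → (Q —[ ip a x ]→ Q') × R (h ∷ʳ (x , tI)) P' Q'

infix 4 _∼_

_∼_ : Proc 0 → Proc 0 → Set₁
P ∼ Q = ∃ λ (xs : List Name) → (fvP P ⊆ xs) × (fvP Q ⊆ xs) ×
        ∃ λ (R : History → Proc 0 → Proc 0 → Set) →
          IsOpenBisim R × R (inputs xs) P Q

-- OM formulae.  The bound-output and input modalities bind index 0.

data Form (n : ℕ) : Set where
  tt ff   : Form n
  _∧_ _∨_ _⊃_ : Form n → Form n → Form n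
  eqF     : Nm n → Nm n → Form n
  ⟨τ⟩ [τ] : Form n → Form n
  ⟨fo⟩ [fo] : Nm n → Nm n → Form n → Form n
  ⟨bo⟩ [bo] : Nm n → Form (suc n) → Form n
  ⟨ip⟩ [ip] : Nm n → Form (suc n) → Form n

extM : ∀ {n} → (Nm n → Maybe Name) → Nm (suc n) → Maybe Name
extM v (fr x)       = v (fr x)
extM v (bd zero)    = nothing
extM v (bd (suc i)) = v (bd i)

fvF : ∀ {n} → (Nm n → Maybe Name) → Form n → List Name
fvF v tt           = []
fvF v ff           = []
fvF v (φ ∧ ψ)      = fvF v φ ++ fvF v ψ
fvF v (φ ∨ ψ)      = fvF v φ ++ fvF v ψ
fvF v (φ ⊃ ψ)      = fvF v φ ++ fvF v ψ
fvF v (eqF a b)    = maybe [_] [] (v a) ++ maybe [_] [] (v b)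
fvF v (⟨τ⟩ φ)      = fvF v φ
fvF v ([τ] φ)      = fvF v φ
fvF v (⟨fo⟩ a b φ) = maybe [_] [] (v a) ++ maybe [_] [] (v b) ++ fvF v φ
fvF v ([fo] a b φ) = maybe [_] [] (v a) ++ maybe [_] [] (v b) ++ fvF v φ
fvF v (⟨bo⟩ a φ)   = maybe [_] [] (v a) ++ fvF (extM v) φ
fvF v ([bo] a φ)   = maybe [_] [] (v a) ++ fvF (extM v) φ
fvF v (⟨ip⟩ a φ)   = maybe [_] [] (v a) ++ fvF (extM v) φ
fvF v ([ip] a φ)   = maybe [_] [] (v a) ++ fvF (extM v) φ

fvForm : Form 0 → List Name
fvForm φ = fvF (just ∘ val) φ

ext : ∀ {n} → (Nm n → Name) → Name → Nm (suc n) → Name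
ext v z (fr x)       = v (fr x)
ext v z (bd zero)    = z
ext v z (bd (suc i)) = v (bd i)

Fresh : ∀ {n} → Name → Proc 0 → History → (Nm n → Name) → Form n → Set
Fresh z P h v ψ = (z ∉ fvP P) × (z ∉ names h) × (z ∉ fvF (just ∘ v) ψ)

-- Sat v h P φ  means  P ⊨^h φv , where φv is φ with every name
-- occurrence a replaced by v a (v accumulates the substitutions σ
-- applied by the ⊃ and box clauses, and the names chosen for binders).
Sat : ∀ {n} → (Nm n → Name) → History → Proc 0 → Form n → Set
Sat v h P tt = ⊤
Sat v h P ff = ⊥
Sat v h P (φ ∧ ψ) = Sat v h P φ × Sat v h P ψ
Sat v h P (φ ∨ ψ) = Sat v h P φ ⊎ Sat v h P ψ
Sat v h P (φ ⊃ ψ) = ∀ σ → Respects σ h →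
  Sat (σ ∘ v) (substH σ h) (substP σ P) φ →
  Sat (σ ∘ v) (substH σ h) (substP σ P) ψ
Sat v h P (eqF a b) = v a ≡ v b
Sat v h P (⟨τ⟩ φ) = ∃ λ Q → (P —[ τ ]→ Q) × Sat v h Q φ
Sat v h P ([τ] φ) = ∀ σ → Respects σ h → ∀ Q →
  substP σ P —[ τ ]→ Q → Sat (σ ∘ v) (substH σ h) Q φ
Sat v h P (⟨fo⟩ a b φ) = ∃ λ Q → (P —[ fo (v a) (v b) ]→ Q) × Sat v h Q φ
Sat v h P ([fo] a b φ) = ∀ σ → Respects σ h → ∀ Q →
  substP σ P —[ fo (σ (v a)) (σ (v b)) ]→ Q → Sat (σ ∘ v) (substH σ h) Q φ
Sat v h P (⟨bo⟩ a φ) = ∃ λ z → Fresh z P h v (⟨bo⟩ a φ) ×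
  ∃ λ Q → (P —[ bo (v a) z ]→ Q) × Sat (ext v z) (h ∷ʳ (z , tO)) Q φ
Sat v h P ([bo] a φ) = ∀ σ → Respects σ h → ∀ z →
  Fresh z (substP σ P) (substH σ h) (σ ∘ v) ([bo] a φ) → ∀ Q →
  substP σ P —[ bo (σ (v a)) z ]→ Q →
  Sat (ext (σ ∘ v) z) (substH σ h ∷ʳ (z , tO)) Q φ
Sat v h P (⟨ip⟩ a φ) = ∃ λ z → Fresh z P h v (⟨ip⟩ a φ) ×
  ∃ λ Q → (P —[ ip (v a) z ]→ Q) × Sat (ext v z) (h ∷ʳ (z , tI)) Q φ
Sat v h P ([ip] a φ) = ∀ σ → Respects σ h → ∀ z →
  Fresh z (substP σ P) (substH σ h) (σ ∘ v) ([ip] a φ) → ∀ Q →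
  substP σ P —[ ip (σ (v a)) z ]→ Q →
  Sat (ext (σ ∘ v) z) (substH σ h ∷ʳ (z , tI)) Q φ

infix 4 _⊨_

_⊨_ : Proc 0 → Form 0 → Set
P ⊨ φ = ∀ (xs : List Name) → fvP P ⊆ xs → fvForm φ ⊆ xs →
        Sat val (inputs xs) P φ

-- A substitution respecting Q's history must be transported to P's history and
-- to the history of the bisimulation.  Satisfaction is therefore transferred from H to G,
-- with H R G, at three histories that share a tail and differ in their leading inputs: H's
-- carries spare input names (those of P) that occur neither in G nor in the formula.  For
-- ⊃ and the boxes a substitution σ respecting G's history is redirected on the spare names
-- to the image of a name of G's history; the result respects the other two histories and
-- agrees with σ on G and on the formula.  After the substitution no spare names remain,
-- so the transfer can be run backwards, which the premise of ⊃ and the boxes require.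
module Submission where

open import Defs
open import Data.Nat using (ℕ; zero; suc; _≡ᵇ_; _≟_)
open import Data.Nat.Properties using (≡ᵇ⇒≡; ≡⇒≡ᵇ)
open import Data.Bool using (true; false)
open import Data.Fin using (Fin; zero; suc)
open import Data.List using (List; []; _∷_; _++_; map; [_]; _∷ʳ_)
open import Data.List.Properties using (++-assoc; ++-identityʳ; map-++; ∷-injective)
open import Data.List.Membership.Propositional using (_∈_; _∉_)
open import Data.List.Membership.Propositional.Properties using (∈-map⁺; ∈-map⁻; ∈-++⁺ˡ; ∈-++⁺ʳ; ∈-++⁻)
open import Data.List.Relation.Unary.Any using (here; there; tail)
open import Data.List.Relation.Unary.All as All using (All; []; _∷_)
open import Data.List.Relation.Unary.All.Properties using (++⁺; ++⁻ˡ; ++⁻ʳ) renaming (map⁺ to All-map⁺)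
open import Data.List.Relation.Binary.Subset.Propositional using (_⊆_)
open import Data.List.Relation.Binary.Subset.Propositional.Properties
  using (⊆-refl; ⊆-trans; xs⊆xs++ys; xs⊆ys++xs; ++⁺ʳ; ∈-∷⁺ʳ; map⁺)
open import Data.Product using (∃; _×_; _,_; proj₁; proj₂; map₁; map₂)
open import Data.Sum using (_⊎_; inj₁; inj₂; [_,_]′)
open import Data.Empty using (⊥; ⊥-elim)
open import Data.Maybe using (Maybe; just; maybe)
open import Relation.Nullary using (yes; no; ¬_)
open import Data.List.Membership.DecPropositional _≟_ using (_∈?_)
open import Function using (_∘_; _$_)
open import Relation.Binary.PropositionalEquality using (_≡_; _≢_; refl; sym; trans; cong; cong₂; subst; subst₂)

private
  variable
    m n : ℕ

weakenNm-fvNm : ∀ {S : Name → Set} (c : Nm n) → All S (fvNm c) → All S (fvNm (weakenNm c))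
weakenNm-fvNm (fr x) s = s
weakenNm-fvNm (bd i) s = s

FreeImages : (Name → Set) → (Nm m → Nm n) → List Name → Set
FreeImages S f = All (λ y → All S (fvNm (f (fr y))))

BoundImages : (Name → Set) → (Nm m → Nm n) → Set
BoundImages {m} S f = ∀ (i : Fin m) → All S (fvNm (f (bd i)))

fvNm-mapNm : ∀ {S} (f : Nm m → Nm n) (c : Nm m) → FreeImages S f (fvNm c) → BoundImages S f →
             All S (fvNm (f c))
fvNm-mapNm f (fr y) (s ∷ []) _ = s
fvNm-mapNm f (bd i) [] b = b i

liftNm-FreeImages : ∀ {S} (f : Nm m → Nm n) {L} → FreeImages S f L → FreeImages S (liftNm f) L
liftNm-FreeImages f = All.map (λ {y} → weakenNm-fvNm (f (fr y)))

liftNm-BoundImages : ∀ {S} (f : Nm m → Nm n) → BoundImages S f → BoundImages S (liftNm f)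
liftNm-BoundImages f b zero    = []
liftNm-BoundImages f b (suc i) = weakenNm-fvNm (f (bd i)) (b i)

fvP-mapP : ∀ {S} (f : Nm m → Nm n) (P : Proc m) → FreeImages S f (fvP P) → BoundImages S f →
           All S (fvP (mapP f P))
fvP-mapP f nil           _ _ = []
fvP-mapP f (nu P)        s b = fvP-mapP (liftNm f) P (liftNm-FreeImages f s) (liftNm-BoundImages f b)
fvP-mapP f (tauP P)      s b = fvP-mapP f P s b
fvP-mapP f (outP a c P)  s b = ++⁺ (fvNm-mapNm f a (++⁻ˡ _ s) b)
  (++⁺ (fvNm-mapNm f c (++⁻ˡ _ (++⁻ʳ (fvNm a) s)) b) (fvP-mapP f P (++⁻ʳ (fvNm c) (++⁻ʳ (fvNm a) s)) b))
fvP-mapP f (boutP a P)   s b = ++⁺ (fvNm-mapNm f a (++⁻ˡ _ s) b)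
  (fvP-mapP (liftNm f) P (liftNm-FreeImages f (++⁻ʳ (fvNm a) s)) (liftNm-BoundImages f b))
fvP-mapP f (inpP a P)    s b = ++⁺ (fvNm-mapNm f a (++⁻ˡ _ s) b)
  (fvP-mapP (liftNm f) P (liftNm-FreeImages f (++⁻ʳ (fvNm a) s)) (liftNm-BoundImages f b))
fvP-mapP f (match a c P) s b = ++⁺ (fvNm-mapNm f a (++⁻ˡ _ s) b)
  (++⁺ (fvNm-mapNm f c (++⁻ˡ _ (++⁻ʳ (fvNm a) s)) b) (fvP-mapP f P (++⁻ʳ (fvNm c) (++⁻ʳ (fvNm a) s)) b))
fvP-mapP f (par P Q)     s b = ++⁺ (fvP-mapP f P (++⁻ˡ _ s) b) (fvP-mapP f Q (++⁻ʳ (fvP P) s) b)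
fvP-mapP f (sum P Q)     s b = ++⁺ (fvP-mapP f P (++⁻ˡ _ s) b) (fvP-mapP f Q (++⁻ʳ (fvP P) s) b)
fvP-mapP f (bang P)      s b = fvP-mapP f P s b

fvP-openP : (P : Proc (suc n)) (z : Name) → fvP (openP P z) ⊆ z ∷ fvP P
fvP-openP P z = All.lookup (fvP-mapP (openNm z) P (All.tabulate (λ q → there q ∷ [])) opened)
  where
  opened : BoundImages (_∈ z ∷ fvP P) (openNm z)
  opened zero    = here refl ∷ []
  opened (suc i) = []

fvP-closeP : (z : Name) (P : Proc n) → ∀ {x} → x ∈ fvP (closeP z P) → x ∈ fvP P × x ≢ z
fvP-closeP z P = All.lookup (fvP-mapP (closeNm z) P (All.tabulate closed) (λ _ → []))
  where
  closed : ∀ {y} → y ∈ fvP P → All (λ x → x ∈ fvP P × x ≢ z) (fvNm (closeNm z (fr y)))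
  -- does (y ≟ z) computes to y ≡ᵇ z, so that is what has to be split on.
  closed {y} q with y ≡ᵇ z | ≡⇒≡ᵇ y z
  ... | true  | _   = []
  ... | false | y≢z = (q , y≢z) ∷ []

fvP-substP : (σ : Subst) (P : Proc n) → fvP (substP σ P) ⊆ map σ (fvP P)
fvP-substP σ P = All.lookup (fvP-mapP (substNm σ) P (All.tabulate (λ q → ∈-map⁺ σ q ∷ [])) (λ _ → []))

mapNm-cong : (f g : Nm m → Nm n) (c : Nm m) → All (λ x → f (fr x) ≡ g (fr x)) (fvNm c) →
             (∀ i → f (bd i) ≡ g (bd i)) → f c ≡ g c
mapNm-cong f g (fr x) (e ∷ []) _ = e
mapNm-cong f g (bd i) []       b = b i

liftNm-cong : (f g : Nm m → Nm n) → (∀ i → f (bd i) ≡ g (bd i)) → ∀ i → liftNm f (bd i) ≡ liftNm g (bd i)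
liftNm-cong f g b zero    = refl
liftNm-cong f g b (suc i) = cong weakenNm (b i)

mapP-cong : (f g : Nm m → Nm n) (P : Proc m) → All (λ x → f (fr x) ≡ g (fr x)) (fvP P) →
            (∀ i → f (bd i) ≡ g (bd i)) → mapP f P ≡ mapP g P
mapP-cong f g nil           _ _ = refl
mapP-cong f g (nu P)        e b =
  cong nu (mapP-cong (liftNm f) (liftNm g) P (All.map (cong weakenNm) e) (liftNm-cong f g b))
mapP-cong f g (tauP P)      e b = cong tauP (mapP-cong f g P e b)
mapP-cong f g (outP a c P)  e b = cong₂ _$_ (cong₂ outP (mapNm-cong f g a (++⁻ˡ _ e) b)
  (mapNm-cong f g c (++⁻ˡ _ (++⁻ʳ (fvNm a) e)) b)) (mapP-cong f g P (++⁻ʳ (fvNm c) (++⁻ʳ (fvNm a) e)) b)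
mapP-cong f g (boutP a P)   e b = cong₂ boutP (mapNm-cong f g a (++⁻ˡ _ e) b)
  (mapP-cong (liftNm f) (liftNm g) P (All.map (cong weakenNm) (++⁻ʳ (fvNm a) e)) (liftNm-cong f g b))
mapP-cong f g (inpP a P)    e b = cong₂ inpP (mapNm-cong f g a (++⁻ˡ _ e) b)
  (mapP-cong (liftNm f) (liftNm g) P (All.map (cong weakenNm) (++⁻ʳ (fvNm a) e)) (liftNm-cong f g b))
mapP-cong f g (match a c P) e b = cong₂ _$_ (cong₂ match (mapNm-cong f g a (++⁻ˡ _ e) b)
  (mapNm-cong f g c (++⁻ˡ _ (++⁻ʳ (fvNm a) e)) b)) (mapP-cong f g P (++⁻ʳ (fvNm c) (++⁻ʳ (fvNm a) e)) b)
mapP-cong f g (par P Q)     e b = cong₂ par (mapP-cong f g P (++⁻ˡ _ e) b) (mapP-cong f g Q (++⁻ʳ (fvP P) e) b)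
mapP-cong f g (sum P Q)     e b = cong₂ sum (mapP-cong f g P (++⁻ˡ _ e) b) (mapP-cong f g Q (++⁻ʳ (fvP P) e) b)
mapP-cong f g (bang P)      e b = cong bang (mapP-cong f g P e b)

substP-cong : (σ σ′ : Subst) (P : Proc n) → All (λ x → σ x ≡ σ′ x) (fvP P) → substP σ P ≡ substP σ′ P
substP-cong σ σ′ P e = mapP-cong (substNm σ) (substNm σ′) P (All.map (cong fr) e) (λ _ → refl)

/-same : (y z : Name) → (y / z) z ≡ y
/-same y z with z ≡ᵇ z | ≡⇒≡ᵇ z z refl
... | true | _ = refl

/-other : (y : Name) {z w : Name} → w ≢ z → (y / z) w ≡ w
/-other y {z} {w} w≢z with w ≡ᵇ z | ≡ᵇ⇒≡ w z
... | false | _   = refl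
... | true  | w≡z = ⊥-elim (w≢z (w≡z _))

++-lub : ∀ {L M N : List Name} → L ⊆ N → M ⊆ N → L ++ M ⊆ N
++-lub {L} s t q = [ s , t ]′ (∈-++⁻ L q)

fvP-substP-/ : ∀ {y z} (Q : Proc 0) {L} → fvP Q ⊆ z ∷ L → fvP (substP (y / z) Q) ⊆ y ∷ L
fvP-substP-/ {y} {z} Q s q with ∈-map⁻ (y / z) (fvP-substP (y / z) Q q)
... | w , w∈Q , refl with w ≟ z
...   | yes refl = here (/-same y w)
...   | no w≢z   = there (subst (_∈ _) (sym (/-other y w≢z)) (tail w≢z (s w∈Q)))

fvP-fo-object : ∀ {P P′ x y} → P —[ fo x y ]→ P′ → y ∈ fvP P
fvP-fo-object (pre-out {a} {fr b})  = ∈-++⁺ʳ (fvNm a) (here refl)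
fvP-fo-object (pre-out {b = bd ()})
fvP-fo-object (sumL t)              = ∈-++⁺ˡ (fvP-fo-object t)
fvP-fo-object (sumR {Q = Q} t)      = ∈-++⁺ʳ (fvP Q) (fvP-fo-object t)
fvP-fo-object (mat {a} {b} _ t)     = ∈-++⁺ʳ (fvNm a) (∈-++⁺ʳ (fvNm b) (fvP-fo-object t))
fvP-fo-object (res {P} {z = z} _ z∉π t) with fvP-openP P z (fvP-fo-object t)
... | here y≡z = ⊥-elim (z∉π (there (here (sym y≡z))))
... | there q  = q
fvP-fo-object (parL t _)            = ∈-++⁺ˡ (fvP-fo-object t)
fvP-fo-object (parR {R = R} t _)    = ∈-++⁺ʳ (fvP R) (fvP-fo-object t)
fvP-fo-object (rep t)               = ++-lub ⊆-refl ⊆-refl (fvP-fo-object t)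

fvP-close : ∀ {z} (P P′ Q Q′ : Proc 0) → fvP P′ ⊆ z ∷ fvP P → fvP Q′ ⊆ z ∷ fvP Q →
            fvP (closeP z (par P′ Q′)) ⊆ fvP P ++ fvP Q
fvP-close {z} P P′ Q Q′ s t q with fvP-closeP z (par P′ Q′) q
... | q′ , x≢z with ∈-++⁻ (fvP P′) q′
...   | inj₁ r = ∈-++⁺ˡ (tail x≢z (s r))
...   | inj₂ r = ∈-++⁺ʳ (fvP P) (tail x≢z (t r))

fvP-target : ∀ {P α P′} → P —[ α ]→ P′ → fvP P′ ⊆ bnA α ++ fvP P
fvP-target pre-τ                     = ⊆-refl
fvP-target (pre-out {a} {b})         = λ q → ∈-++⁺ʳ (fvNm a) (∈-++⁺ʳ (fvNm b) q)
fvP-target (pre-bout {a} {P} {z} _)  = ⊆-trans (fvP-openP P z) (++⁺ʳ [ z ] (xs⊆ys++xs (fvP P) (fvNm a)))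
fvP-target (pre-in {a} {P} {z} _)    = ⊆-trans (fvP-openP P z) (++⁺ʳ [ z ] (xs⊆ys++xs (fvP P) (fvNm a)))
fvP-target (opn {P} {z = z} _ _ t)   = ⊆-trans (fvP-target t) (fvP-openP P z)
fvP-target (sumL {π = π} t)          = ⊆-trans (fvP-target t) (++⁺ʳ (bnA π) (xs⊆xs++ys _ _))
fvP-target (sumR {Q = Q} {π = π} t)  = ⊆-trans (fvP-target t) (++⁺ʳ (bnA π) (xs⊆ys++xs _ (fvP Q)))
fvP-target (mat {a} {b} {π = π} _ t) =
  ⊆-trans (fvP-target t) (++⁺ʳ (bnA π) (λ q → ∈-++⁺ʳ (fvNm a) (∈-++⁺ʳ (fvNm b) q)))
fvP-target (res {P} {Q} {z} {π} _ _ t) q with fvP-closeP z Q q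
... | q′ , x≢z with ∈-++⁻ (bnA π) (fvP-target t q′)
...   | inj₁ b = ∈-++⁺ˡ b
...   | inj₂ r = ∈-++⁺ʳ (bnA π) (tail x≢z (fvP-openP P z r))
fvP-target (parL {P} {R = R} {π} t _) = ++-lub (⊆-trans (fvP-target t) (++⁺ʳ (bnA π) (xs⊆xs++ys _ _)))
  (⊆-trans (xs⊆ys++xs (fvP R) (fvP P)) (xs⊆ys++xs _ (bnA π)))
fvP-target (parR {P} {R = R} {π} t _) = ++-lub (⊆-trans (xs⊆xs++ys (fvP R) (fvP P)) (xs⊆ys++xs _ (bnA π)))
  (⊆-trans (fvP-target t) (++⁺ʳ (bnA π) (xs⊆ys++xs _ (fvP R))))
fvP-target (closeL {P} {P'} {Q} {Q'} t u) = fvP-close P P' Q Q' (fvP-target t) (fvP-target u)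
fvP-target (closeR {P} {P'} {Q} {Q'} t u) = fvP-close Q Q' P P' (fvP-target u) (fvP-target t)
fvP-target (commL {Q' = Q′} t u) = ++-lub (⊆-trans (fvP-target t) (xs⊆xs++ys _ _))
  (⊆-trans (fvP-substP-/ Q′ (fvP-target u)) (∈-∷⁺ʳ (∈-++⁺ˡ (fvP-fo-object t)) (xs⊆ys++xs _ _)))
fvP-target (commR {P} {Q' = Q′} t u) =
  ++-lub (⊆-trans (fvP-substP-/ Q′ (fvP-target u)) (∈-∷⁺ʳ (∈-++⁺ʳ _ (fvP-fo-object t)) (xs⊆xs++ys _ _)))
         (⊆-trans (fvP-target t) (xs⊆ys++xs _ _))
fvP-target (rep {π = π} t) = ⊆-trans (fvP-target t) (++⁺ʳ (bnA π) (++-lub ⊆-refl ⊆-refl))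

names-inputs : ∀ D → names (inputs D) ≡ D
names-inputs []      = refl
names-inputs (x ∷ D) = cong (x ∷_) (names-inputs D)

names-inputs-++ : ∀ D k → names (inputs D ++ k) ≡ D ++ names k
names-inputs-++ D k = trans (map-++ proj₁ (inputs D) k) (cong (_++ names k) (names-inputs D))

names-substH : ∀ σ h → names (substH σ h) ≡ map σ (names h)
names-substH σ []      = refl
names-substH σ (p ∷ h) = cong (σ (proj₁ p) ∷_) (names-substH σ h)

substH-inputs-++ : ∀ σ D k → substH σ (inputs D ++ k) ≡ inputs (map σ D) ++ substH σ k
substH-inputs-++ σ []      k = refl
substH-inputs-++ σ (x ∷ D) k = cong ((σ x , tI) ∷_) (substH-inputs-++ σ D k)

substH-cong : ∀ {σ σ′} k → All (λ x → σ x ≡ σ′ x) (names k) → substH σ k ≡ substH σ′ k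
substH-cong []            []      = refl
substH-cong ((x , t) ∷ k) (e ∷ es) = cong₂ _∷_ (cong (_, t) e) (substH-cong k es)

inputs-++-split : ∀ D k h′ x h″ → inputs D ++ k ≡ h′ ++ (x , tO) ∷ h″ →
                  ∃ λ k′ → (h′ ≡ inputs D ++ k′) × (k ≡ k′ ++ (x , tO) ∷ h″)
inputs-++-split []      k h′       x h″ e = h′ , refl , e
inputs-++-split (d ∷ D) k []       x h″ ()
inputs-++-split (d ∷ D) k (p ∷ h′) x h″ e with ∷-injective e
... | refl , e′ with inputs-++-split D k h′ x h″ e′
...   | k′ , refl , k≡ = k′ , refl , k≡

Occurs : Form n → Nm n → Set
Occurs tt           c = ⊥
Occurs ff           c = ⊥
Occurs (φ ∧ ψ)      c = Occurs φ c ⊎ Occurs ψ c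
Occurs (φ ∨ ψ)      c = Occurs φ c ⊎ Occurs ψ c
Occurs (φ ⊃ ψ)      c = Occurs φ c ⊎ Occurs ψ c
Occurs (eqF a b)    c = c ≡ a ⊎ c ≡ b
Occurs (⟨τ⟩ φ)      c = Occurs φ c
Occurs ([τ] φ)      c = Occurs φ c
Occurs (⟨fo⟩ a b φ) c = c ≡ a ⊎ c ≡ b ⊎ Occurs φ c
Occurs ([fo] a b φ) c = c ≡ a ⊎ c ≡ b ⊎ Occurs φ c
Occurs (⟨bo⟩ a φ)   c = c ≡ a ⊎ Occurs φ (weakenNm c)
Occurs ([bo] a φ)   c = c ≡ a ⊎ Occurs φ (weakenNm c)
Occurs (⟨ip⟩ a φ)   c = c ≡ a ⊎ Occurs φ (weakenNm c)
Occurs ([ip] a φ)   c = c ≡ a ⊎ Occurs φ (weakenNm c)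

Agree : ∀ {A : Set} → Form n → (Nm n → A) → (Nm n → A) → Set
Agree φ w₁ w₂ = ∀ c → Occurs φ c → w₁ c ≡ w₂ c

AgreeB : ∀ {A : Set} → Nm n → Form (suc n) → (Nm n → A) → (Nm n → A) → Set
AgreeB a φ w₁ w₂ = ∀ c → c ≡ a ⊎ Occurs φ (weakenNm c) → w₁ c ≡ w₂ c

Agree-ext : ∀ a (φ : Form (suc n)) {v₁ v₂ : Nm n → Name} z → AgreeB a φ v₁ v₂ → Agree φ (ext v₁ z) (ext v₂ z)
Agree-ext a φ z ag (fr x)       o = ag (fr x) (inj₂ o)
Agree-ext a φ z ag (bd zero)    o = refl
Agree-ext a φ z ag (bd (suc i)) o = ag (bd i) (inj₂ o)

fvMaybe : Maybe Name → List Name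
fvMaybe = maybe [_] []

∈-fvMaybe⁺ : ∀ {m x} → m ≡ just x → x ∈ fvMaybe m
∈-fvMaybe⁺ refl = here refl

∈-fvMaybe⁻ : ∀ {m x} → x ∈ fvMaybe m → m ≡ just x
∈-fvMaybe⁻ {just y} (here refl) = refl

extM-weakenNm : ∀ (w : Nm n → Maybe Name) c → extM w (weakenNm c) ≡ w c
extM-weakenNm w (fr x) = refl
extM-weakenNm w (bd i) = refl

Occurs⇒∈fvF : ∀ (φ : Form n) w {c x} → Occurs φ c → w c ≡ just x → x ∈ fvF w φ
Occurs⇒∈fvF (φ ∧ ψ)      w (inj₁ o)        e = ∈-++⁺ˡ (Occurs⇒∈fvF φ w o e)
Occurs⇒∈fvF (φ ∧ ψ)      w (inj₂ o)        e = ∈-++⁺ʳ (fvF w φ) (Occurs⇒∈fvF ψ w o e)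
Occurs⇒∈fvF (φ ∨ ψ)      w (inj₁ o)        e = ∈-++⁺ˡ (Occurs⇒∈fvF φ w o e)
Occurs⇒∈fvF (φ ∨ ψ)      w (inj₂ o)        e = ∈-++⁺ʳ (fvF w φ) (Occurs⇒∈fvF ψ w o e)
Occurs⇒∈fvF (φ ⊃ ψ)      w (inj₁ o)        e = ∈-++⁺ˡ (Occurs⇒∈fvF φ w o e)
Occurs⇒∈fvF (φ ⊃ ψ)      w (inj₂ o)        e = ∈-++⁺ʳ (fvF w φ) (Occurs⇒∈fvF ψ w o e)
Occurs⇒∈fvF (eqF a b)    w (inj₁ refl)     e = ∈-++⁺ˡ (∈-fvMaybe⁺ e)
Occurs⇒∈fvF (eqF a b)    w (inj₂ refl)     e = ∈-++⁺ʳ (fvMaybe (w a)) (∈-fvMaybe⁺ e)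
Occurs⇒∈fvF (⟨τ⟩ φ)      w o               e = Occurs⇒∈fvF φ w o e
Occurs⇒∈fvF ([τ] φ)      w o               e = Occurs⇒∈fvF φ w o e
Occurs⇒∈fvF (⟨fo⟩ a b φ) w (inj₁ refl)     e = ∈-++⁺ˡ (∈-fvMaybe⁺ e)
Occurs⇒∈fvF (⟨fo⟩ a b φ) w (inj₂ (inj₁ refl)) e = ∈-++⁺ʳ (fvMaybe (w a)) (∈-++⁺ˡ (∈-fvMaybe⁺ e))
Occurs⇒∈fvF (⟨fo⟩ a b φ) w (inj₂ (inj₂ o)) e =
  ∈-++⁺ʳ (fvMaybe (w a)) (∈-++⁺ʳ (fvMaybe (w b)) (Occurs⇒∈fvF φ w o e))
Occurs⇒∈fvF ([fo] a b φ) w (inj₁ refl)     e = ∈-++⁺ˡ (∈-fvMaybe⁺ e)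
Occurs⇒∈fvF ([fo] a b φ) w (inj₂ (inj₁ refl)) e = ∈-++⁺ʳ (fvMaybe (w a)) (∈-++⁺ˡ (∈-fvMaybe⁺ e))
Occurs⇒∈fvF ([fo] a b φ) w (inj₂ (inj₂ o)) e =
  ∈-++⁺ʳ (fvMaybe (w a)) (∈-++⁺ʳ (fvMaybe (w b)) (Occurs⇒∈fvF φ w o e))
Occurs⇒∈fvF (⟨bo⟩ a φ)   w (inj₁ refl)     e = ∈-++⁺ˡ (∈-fvMaybe⁺ e)
Occurs⇒∈fvF (⟨bo⟩ a φ)   w {c} (inj₂ o)    e =
  ∈-++⁺ʳ (fvMaybe (w a)) (Occurs⇒∈fvF φ (extM w) o (trans (extM-weakenNm w c) e))
Occurs⇒∈fvF ([bo] a φ)   w (inj₁ refl)     e = ∈-++⁺ˡ (∈-fvMaybe⁺ e)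
Occurs⇒∈fvF ([bo] a φ)   w {c} (inj₂ o)    e =
  ∈-++⁺ʳ (fvMaybe (w a)) (Occurs⇒∈fvF φ (extM w) o (trans (extM-weakenNm w c) e))
Occurs⇒∈fvF (⟨ip⟩ a φ)   w (inj₁ refl)     e = ∈-++⁺ˡ (∈-fvMaybe⁺ e)
Occurs⇒∈fvF (⟨ip⟩ a φ)   w {c} (inj₂ o)    e =
  ∈-++⁺ʳ (fvMaybe (w a)) (Occurs⇒∈fvF φ (extM w) o (trans (extM-weakenNm w c) e))
Occurs⇒∈fvF ([ip] a φ)   w (inj₁ refl)     e = ∈-++⁺ˡ (∈-fvMaybe⁺ e)
Occurs⇒∈fvF ([ip] a φ)   w {c} (inj₂ o)    e =
  ∈-++⁺ʳ (fvMaybe (w a)) (Occurs⇒∈fvF φ (extM w) o (trans (extM-weakenNm w c) e))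

OccursWith : Form n → (Nm n → Maybe Name) → Name → Set
OccursWith φ w x = ∃ λ c → Occurs φ c × w c ≡ just x

∈fvF⇒Occurs : ∀ (φ : Form n) w {x} → x ∈ fvF w φ → OccursWith φ w x
∈fvF-binary⇒Occurs : ∀ (φ ψ : Form n) w {x} → x ∈ fvF w φ ++ fvF w ψ →
                      ∃ λ c → (Occurs φ c ⊎ Occurs ψ c) × w c ≡ just x
∈fvF-fo⇒Occurs : ∀ a b (φ : Form n) w {x} → x ∈ fvMaybe (w a) ++ fvMaybe (w b) ++ fvF w φ →
                  ∃ λ c → (c ≡ a ⊎ c ≡ b ⊎ Occurs φ c) × w c ≡ just x
∈fvF-binder⇒Occurs : ∀ a (φ : Form (suc n)) w {x} → x ∈ fvMaybe (w a) ++ fvF (extM w) φ →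
                      ∃ λ c → (c ≡ a ⊎ Occurs φ (weakenNm c)) × w c ≡ just x

∈fvF⇒Occurs (φ ∧ ψ)      w q = ∈fvF-binary⇒Occurs φ ψ w q
∈fvF⇒Occurs (φ ∨ ψ)      w q = ∈fvF-binary⇒Occurs φ ψ w q
∈fvF⇒Occurs (φ ⊃ ψ)      w q = ∈fvF-binary⇒Occurs φ ψ w q
∈fvF⇒Occurs (eqF a b)    w q with ∈-++⁻ (fvMaybe (w a)) q
... | inj₁ r = a , inj₁ refl , ∈-fvMaybe⁻ r
... | inj₂ r = b , inj₂ refl , ∈-fvMaybe⁻ r
∈fvF⇒Occurs (⟨τ⟩ φ)      w q = ∈fvF⇒Occurs φ w q
∈fvF⇒Occurs ([τ] φ)      w q = ∈fvF⇒Occurs φ w q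
∈fvF⇒Occurs (⟨fo⟩ a b φ) w q = ∈fvF-fo⇒Occurs a b φ w q
∈fvF⇒Occurs ([fo] a b φ) w q = ∈fvF-fo⇒Occurs a b φ w q
∈fvF⇒Occurs (⟨bo⟩ a φ)   w q = ∈fvF-binder⇒Occurs a φ w q
∈fvF⇒Occurs ([bo] a φ)   w q = ∈fvF-binder⇒Occurs a φ w q
∈fvF⇒Occurs (⟨ip⟩ a φ)   w q = ∈fvF-binder⇒Occurs a φ w q
∈fvF⇒Occurs ([ip] a φ)   w q = ∈fvF-binder⇒Occurs a φ w q

∈fvF-binary⇒Occurs φ ψ w q with ∈-++⁻ (fvF w φ) q
... | inj₁ r = map₂ (map₁ inj₁) (∈fvF⇒Occurs φ w r)
... | inj₂ r = map₂ (map₁ inj₂) (∈fvF⇒Occurs ψ w r)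

∈fvF-fo⇒Occurs a b φ w q with ∈-++⁻ (fvMaybe (w a)) q
... | inj₁ r = a , inj₁ refl , ∈-fvMaybe⁻ r
... | inj₂ r with ∈-++⁻ (fvMaybe (w b)) r
...   | inj₁ s = b , inj₂ (inj₁ refl) , ∈-fvMaybe⁻ s
...   | inj₂ s = map₂ (map₁ (inj₂ ∘ inj₂)) (∈fvF⇒Occurs φ w s)

∈fvF-binder⇒Occurs a φ w q with ∈-++⁻ (fvMaybe (w a)) q
... | inj₁ r = a , inj₁ refl , ∈-fvMaybe⁻ r
... | inj₂ r with ∈fvF⇒Occurs φ (extM w) r
...   | fr y       , o , e = fr y , inj₂ o , e
...   | bd (suc i) , o , e = bd i , inj₂ o , e

fvF-cong : ∀ (φ : Form n) {w₁ w₂} → Agree φ w₁ w₂ → fvF w₁ φ ⊆ fvF w₂ φ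
fvF-cong φ ag q with ∈fvF⇒Occurs φ _ q
... | c , o , e = Occurs⇒∈fvF φ _ o (trans (sym (ag c o)) e)

fvF-ext : ∀ (φ : Form (suc n)) v z → fvF (just ∘ ext v z) φ ⊆ z ∷ fvF (extM (just ∘ v)) φ
fvF-ext φ v z q with ∈fvF⇒Occurs φ _ q
... | bd zero    , o , refl = here refl
... | fr y       , o , e    = there (Occurs⇒∈fvF φ _ o e)
... | bd (suc i) , o , e    = there (Occurs⇒∈fvF φ _ o e)

fvB : (Nm n → Name) → Nm n → Form (suc n) → List Name
fvB v a φ = v a ∷ fvF (extM (just ∘ v)) φ

fvB-cong : ∀ a (φ : Form (suc n)) {v₁ v₂} → AgreeB a φ v₁ v₂ → fvB v₁ a φ ⊆ fvB v₂ a φ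
fvB-cong a φ ag = fvF-cong (⟨bo⟩ a φ) (λ c o → cong just (ag c o))

FreshB : Name → Proc 0 → History → (Nm n → Name) → Nm n → Form (suc n) → Set
FreshB z P h v a φ = (z ∉ fvP P) × (z ∉ names h) × (z ∉ fvB v a φ)

-- Sat v h P (⟨bo⟩ a φ) is definitionally Dia bo tO v h P a φ, and similarly for
-- ⟨ip⟩ (with ip, tI) and for the boxes with Box, so the four binding modalities share proofs.
Dia : (Name → Name → Act) → Tag → (Nm n → Name) → History → Proc 0 → Nm n → Form (suc n) → Set
Dia act t v h P a φ = ∃ λ z → FreshB z P h v a φ ×
  ∃ λ Q → (P —[ act (v a) z ]→ Q) × Sat (ext v z) (h ∷ʳ (z , t)) Q φ

Box : (Name → Name → Act) → Tag → (Nm n → Name) → History → Proc 0 → Nm n → Form (suc n) → Set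
Box act t v h P a φ = ∀ σ → Respects σ h → ∀ z → FreshB z (substP σ P) (substH σ h) (σ ∘ v) a φ →
  ∀ Q → substP σ P —[ act (σ (v a)) z ]→ Q → Sat (ext (σ ∘ v) z) (substH σ h ∷ʳ (z , t)) Q φ

Dia-cong : ∀ act t a (φ : Form (suc n)) {v₁ v₂ h P} → AgreeB a φ v₁ v₂ →
           (∀ z {h′ Q} → Sat (ext v₁ z) h′ Q φ → Sat (ext v₂ z) h′ Q φ) →
           Dia act t v₁ h P a φ → Dia act t v₂ h P a φ
Dia-cong act t a φ {P = P} ag body (z , (z∉P , z∉h , z∉φ) , Q , tr , s) =
  z , (z∉P , z∉h , λ q → z∉φ (fvB-cong a φ (λ c o → sym (ag c o)) q)) ,
  Q , subst (λ x → P —[ act x z ]→ Q) (ag a (inj₁ refl)) tr , body z s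

Box-cong : ∀ act t a (φ : Form (suc n)) {v₁ v₂ h P} → AgreeB a φ v₁ v₂ →
           (∀ σ z {h′ Q} → Sat (ext (σ ∘ v₁) z) h′ Q φ → Sat (ext (σ ∘ v₂) z) h′ Q φ) →
           Box act t v₁ h P a φ → Box act t v₂ h P a φ
Box-cong act t a φ {P = P} ag body s σ resp z (z∉P , z∉h , z∉φ) Q tr =
  body σ z (s σ resp z (z∉P , z∉h , λ q → z∉φ (fvB-cong a φ (λ c o → cong σ (ag c o)) q)) Q
              (subst (λ x → substP σ P —[ act (σ x) z ]→ Q) (sym (ag a (inj₁ refl))) tr))

Sat-cong : ∀ (φ : Form n) {v₁ v₂ h P} → Agree φ v₁ v₂ → Sat v₁ h P φ → Sat v₂ h P φ
Sat-cong tt           ag s         = s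
Sat-cong (φ ∧ ψ)      ag (s , s′)  =
  Sat-cong φ (λ c o → ag c (inj₁ o)) s , Sat-cong ψ (λ c o → ag c (inj₂ o)) s′
Sat-cong (φ ∨ ψ)      ag (inj₁ s)  = inj₁ (Sat-cong φ (λ c o → ag c (inj₁ o)) s)
Sat-cong (φ ∨ ψ)      ag (inj₂ s)  = inj₂ (Sat-cong ψ (λ c o → ag c (inj₂ o)) s)
Sat-cong (φ ⊃ ψ)      ag s σ resp s₁ =
  Sat-cong ψ (λ c o → cong σ (ag c (inj₂ o)))
    (s σ resp (Sat-cong φ (λ c o → cong σ (sym (ag c (inj₁ o)))) s₁))
Sat-cong (eqF a b)    ag e         = trans (sym (ag a (inj₁ refl))) (trans e (ag b (inj₂ refl)))
Sat-cong (⟨τ⟩ φ)      ag (Q , t , s) = Q , t , Sat-cong φ ag s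
Sat-cong ([τ] φ)      ag s σ resp Q t = Sat-cong φ (λ c o → cong σ (ag c o)) (s σ resp Q t)
Sat-cong (⟨fo⟩ a b φ) {P = P} ag (Q , t , s) =
  Q , subst₂ (λ x y → P —[ fo x y ]→ Q) (ag a (inj₁ refl)) (ag b (inj₂ (inj₁ refl))) t ,
  Sat-cong φ (λ c o → ag c (inj₂ (inj₂ o))) s
Sat-cong ([fo] a b φ) {P = P} ag s σ resp Q t =
  Sat-cong φ (λ c o → cong σ (ag c (inj₂ (inj₂ o))))
    (s σ resp Q (subst₂ (λ x y → substP σ P —[ fo (σ x) (σ y) ]→ Q)
                        (sym (ag a (inj₁ refl))) (sym (ag b (inj₂ (inj₁ refl)))) t))
Sat-cong (⟨bo⟩ a φ) ag = Dia-cong bo tO a φ ag (λ z → Sat-cong φ (Agree-ext a φ z ag))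
Sat-cong (⟨ip⟩ a φ) ag = Dia-cong ip tI a φ ag (λ z → Sat-cong φ (Agree-ext a φ z ag))
Sat-cong ([bo] a φ) ag =
  Box-cong bo tO a φ ag (λ σ z → Sat-cong φ (Agree-ext a φ z (λ c o → cong σ (ag c o))))
Sat-cong ([ip] a φ) ag =
  Box-cong ip tI a φ ag (λ σ z → Sat-cong φ (Agree-ext a φ z (λ c o → cong σ (ag c o))))

∈-names-inputs-++⁺ˡ : ∀ {D} k {y} → y ∈ D → y ∈ names (inputs D ++ k)
∈-names-inputs-++⁺ˡ {D} k q = subst (_ ∈_) (sym (names-inputs-++ D k)) (∈-++⁺ˡ q)

∈-names-inputs-++⁺ʳ : ∀ D {k y} → y ∈ names k → y ∈ names (inputs D ++ k)
∈-names-inputs-++⁺ʳ D {k} q = subst (_ ∈_) (sym (names-inputs-++ D k)) (∈-++⁺ʳ D q)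

∈-names-inputs-++⁻ : ∀ D {k y} → y ∈ names (inputs D ++ k) → y ∈ D ⊎ y ∈ names k
∈-names-inputs-++⁻ D {k} q = ∈-++⁻ D (subst (_ ∈_) (names-inputs-++ D k) q)

names-∷ʳ⁻ : ∀ h {z t} → names (h ∷ʳ (z , t)) ⊆ z ∷ names h
names-∷ʳ⁻ []      q         = q
names-∷ʳ⁻ (p ∷ h) (here e)  = there (here e)
names-∷ʳ⁻ (p ∷ h) (there q) with names-∷ʳ⁻ h q
... | here e  = here e
... | there r = there (there r)

names-∷ʳ⁺ : ∀ h {z t} → z ∷ names h ⊆ names (h ∷ʳ (z , t))
names-∷ʳ⁺ []      q                 = q
names-∷ʳ⁺ (p ∷ h) (here e)          = there (names-∷ʳ⁺ h (here e))
names-∷ʳ⁺ (p ∷ h) (there (here e))  = here e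
names-∷ʳ⁺ (p ∷ h) (there (there q)) = there (names-∷ʳ⁺ h (there q))

∉-∷ : ∀ {y z} {L : List Name} → y ≢ z → y ∉ L → y ∉ z ∷ L
∉-∷ y≢z y∉L (here e)  = y≢z e
∉-∷ y≢z y∉L (there q) = y∉L q

-- H satisfies the formula at hH, G is to satisfy it at hG, and R relates H and G at hR;
-- F are the free names of the formula.  The names of A not in B are the spare ones.
record Aligned (hH hG hR : History) (H G : Proc 0) (F : List Name) : Set where
  constructor aligned
  field
    A B C       : List Name
    shared      : History
    pivot       : Name
    hH≡         : hH ≡ inputs A ++ shared
    hG≡         : hG ≡ inputs B ++ shared
    hR≡         : hR ≡ inputs C ++ shared
    pivot∈B     : pivot ∈ B
    B⊆A         : B ⊆ A
    C⊆A         : C ⊆ A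
    spare-fresh : ∀ {y} → y ∈ A → y ∉ B → (y ∉ names shared) × (y ∉ fvP G) × (y ∉ F)
    fvH⊆        : fvP H ⊆ names hH
    fvG⊆        : fvP G ⊆ names hG

module _ {hH hG hR H G F} (I : Aligned hH hG hR H G F) where
  open Aligned I

  names-⊆ : ∀ {D E h h′} → h ≡ inputs D ++ shared → h′ ≡ inputs E ++ shared → D ⊆ E → names h ⊆ names h′
  names-⊆ {D} {E} refl refl D⊆E q with ∈-names-inputs-++⁻ D q
  ... | inj₁ d = ∈-names-inputs-++⁺ˡ shared (D⊆E d)
  ... | inj₂ s = ∈-names-inputs-++⁺ʳ E s

  fresh-hG : ∀ {z} → z ∉ names hH → z ∉ names hG
  fresh-hG z∉ q = z∉ (names-⊆ hG≡ hH≡ B⊆A q)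

  fresh-hR : ∀ {z} → z ∉ names hH → z ∉ names hR
  fresh-hR z∉ q = z∉ (names-⊆ hR≡ hH≡ C⊆A q)

  fresh-G : ∀ {z} → z ∉ names hH → z ∉ fvP G
  fresh-G z∉ q = fresh-hG z∉ (fvG⊆ q)

  Aligned-mono : ∀ {H′ G′ F′} → fvP H′ ⊆ fvP H → fvP G′ ⊆ fvP G → F′ ⊆ F → Aligned hH hG hR H′ G′ F′
  Aligned-mono sH sG sF = aligned A B C shared pivot hH≡ hG≡ hR≡ pivot∈B B⊆A C⊆A
    (λ y∈A y∉B → let (y∉s , y∉G , y∉F) = spare-fresh y∈A y∉B in y∉s , (λ q → y∉G (sG q)) , (λ q → y∉F (sF q)))
    (⊆-trans sH fvH⊆) (⊆-trans sG fvG⊆)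

  Aligned-extend : ∀ {z t H′ G′ F′} → z ∉ names hH →
                   fvP H′ ⊆ z ∷ fvP H → fvP G′ ⊆ z ∷ fvP G → F′ ⊆ z ∷ F →
                   Aligned (hH ∷ʳ (z , t)) (hG ∷ʳ (z , t)) (hR ∷ʳ (z , t)) H′ G′ F′
  Aligned-extend {z} {t} {H′} {G′} {F′} z∉hH sH sG sF = aligned A B C (shared ∷ʳ (z , t)) pivot
    (extend hH≡) (extend hG≡) (extend hR≡) pivot∈B B⊆A C⊆A spare
    (⊆-trans sH (⊆-trans (++⁺ʳ [ z ] fvH⊆) (names-∷ʳ⁺ hH)))
    (⊆-trans sG (⊆-trans (++⁺ʳ [ z ] fvG⊆) (names-∷ʳ⁺ hG)))
    where
    extend : ∀ {h D} → h ≡ inputs D ++ shared → h ∷ʳ (z , t) ≡ inputs D ++ shared ∷ʳ (z , t)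
    extend {D = D} refl = ++-assoc (inputs D) shared [ (z , t) ]
    spare : ∀ {y} → y ∈ A → y ∉ B → (y ∉ names (shared ∷ʳ (z , t))) × (y ∉ fvP G′) × (y ∉ F′)
    spare {y} y∈A y∉B with spare-fresh y∈A y∉B
    ... | y∉s , y∉G , y∉F = (λ q → ∉-∷ y≢z y∉s (names-∷ʳ⁻ shared q)) ,
                            (λ q → ∉-∷ y≢z y∉G (sG q)) , (λ q → ∉-∷ y≢z y∉F (sF q))
      where
      y≢z : y ≢ z
      y≢z refl = z∉hH (subst (λ h → y ∈ names h) (sym hH≡) (∈-names-inputs-++⁺ˡ shared y∈A))

  Aligned-swap : ∀ {F′} → A ⊆ B → Aligned hG hH hR G H F′
  Aligned-swap A⊆B = aligned B A C shared pivot hG≡ hH≡ hR≡ (B⊆A pivot∈B) A⊆B (⊆-trans C⊆A A⊆B)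
    (λ y∈B y∉A → ⊥-elim (y∉A (B⊆A y∈B))) fvG⊆ fvH⊆

fvP-substP-names : ∀ ρ (P : Proc 0) {h} → fvP P ⊆ names h → fvP (substP ρ P) ⊆ names (substH ρ h)
fvP-substP-names ρ P {h} s q = subst (_ ∈_) (sym (names-substH ρ h)) (map⁺ ρ s (fvP-substP ρ P q))

module Redirect {hH hG hR H G F} (I : Aligned hH hG hR H G F) (σ : Subst) where
  open Aligned I

  redirect : Subst
  redirect y with y ∈? A | y ∈? B
  ... | yes _ | no _  = σ pivot
  ... | yes _ | yes _ = σ y
  ... | no _  | _     = σ y

  redirect-unspare : ∀ {y} → (y ∈ A → y ∉ B → ⊥) → redirect y ≡ σ y
  redirect-unspare {y} unspare with y ∈? A | y ∈? B
  ... | yes y∈A | no y∉B = ⊥-elim (unspare y∈A y∉B)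
  ... | yes _   | yes _  = refl
  ... | no _    | _      = refl

  redirect-∈A : ∀ {y} → y ∈ A → ∃ λ b → b ∈ B × redirect y ≡ σ b
  redirect-∈A {y} y∈A with y ∈? A | y ∈? B
  ... | yes _  | no _    = pivot , pivot∈B , refl
  ... | yes _  | yes y∈B = y , y∈B , refl
  ... | no y∉A | _       = ⊥-elim (y∉A y∈A)

  redirect-shared : ∀ {y} → y ∈ names shared → redirect y ≡ σ y
  redirect-shared q = redirect-unspare (λ y∈A y∉B → proj₁ (spare-fresh y∈A y∉B) q)

  substP-redirect-G : substP redirect G ≡ substP σ G
  substP-redirect-G = substP-cong redirect σ G
    (All.tabulate (λ q → redirect-unspare (λ y∈A y∉B → proj₁ (proj₂ (spare-fresh y∈A y∉B)) q)))

  redirect-agree : ∀ {n} (φ : Form n) v → fvF (just ∘ v) φ ⊆ F → Agree φ (redirect ∘ v) (σ ∘ v)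
  redirect-agree φ v s c o = redirect-unspare
    (λ y∈A y∉B → proj₂ (proj₂ (spare-fresh y∈A y∉B)) (s (Occurs⇒∈fvF φ (just ∘ v) o refl)))

  map-redirect-A⊆ : map redirect A ⊆ map σ B
  map-redirect-A⊆ q with ∈-map⁻ redirect q
  ... | y , y∈A , refl with redirect-∈A y∈A
  ...   | b , b∈B , e = subst (_∈ map σ B) (sym e) (∈-map⁺ σ b∈B)

  map-σ-B⊆ : map σ B ⊆ map redirect A
  map-σ-B⊆ q with ∈-map⁻ σ q
  ... | b , b∈B , refl =
    subst (_∈ map redirect A) (redirect-unspare (λ _ b∉B → b∉B b∈B)) (∈-map⁺ redirect (B⊆A b∈B))

  -- An output x of h lies in the shared tail, where redirect agrees with σ; every name
  -- before it is sent into σ B or is in the tail, and σ keeps those away from x.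
  redirect-respects : Respects σ hG → ∀ {D h} → D ⊆ A → h ≡ inputs D ++ shared → Respects redirect h
  redirect-respects resp {D} D⊆A refl h′ x h″ e with inputs-++-split D shared h′ x h″ e
  ... | k′ , refl , shared≡ =
    trans (redirect-shared (in-shared (∈-++⁺ʳ (names k′) (here refl)))) (proj₁ σ-resp) , avoid
    where
    σ-resp : (σ x ≡ x) × (∀ y → y ∈ names (inputs B ++ k′) → σ y ≢ x)
    σ-resp = resp (inputs B ++ k′) x h″
      (trans hG≡ (trans (cong (inputs B ++_) shared≡) (sym (++-assoc (inputs B) k′ _))))
    in-shared : ∀ {y} → y ∈ names k′ ++ x ∷ names h″ → y ∈ names shared
    in-shared q = subst (λ k → _ ∈ names k) (sym shared≡) (subst (_ ∈_) (sym (map-++ proj₁ k′ _)) q)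
    avoid : ∀ y → y ∈ names (inputs D ++ k′) → redirect y ≢ x
    avoid y q with ∈-names-inputs-++⁻ D q
    ... | inj₁ y∈D with redirect-∈A (D⊆A y∈D)
    ...   | b , b∈B , e = λ ex → proj₂ σ-resp b (∈-names-inputs-++⁺ˡ k′ b∈B) (trans (sym e) ex)
    avoid y q | inj₂ y∈k′ = λ ex →
      proj₂ σ-resp y (∈-names-inputs-++⁺ʳ B y∈k′) (trans (sym (redirect-shared (in-shared (∈-++⁺ˡ y∈k′)))) ex)

  redirect-respects-hH : Respects σ hG → Respects redirect hH
  redirect-respects-hH resp = redirect-respects resp ⊆-refl hH≡

  redirect-respects-hR : Respects σ hG → Respects redirect hR
  redirect-respects-hR resp = redirect-respects resp C⊆A hR≡

  Aligned-redirect : ∀ {F′} → Aligned (substH redirect hH) (substH σ hG) (substH redirect hR)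
                                      (substP redirect H) (substP σ G) F′
  Aligned-redirect = aligned (map redirect A) (map σ B) (map redirect C) (substH σ shared) (σ pivot)
    (redirected hH≡ redirect-shared-tail) (redirected hG≡ refl) (redirected hR≡ redirect-shared-tail)
    (∈-map⁺ σ pivot∈B) map-σ-B⊆ (map⁺ redirect C⊆A) (λ y∈A y∉B → ⊥-elim (y∉B (map-redirect-A⊆ y∈A)))
    (fvP-substP-names redirect H fvH⊆) (fvP-substP-names σ G fvG⊆)
    where
    redirect-shared-tail : substH redirect shared ≡ substH σ shared
    redirect-shared-tail = substH-cong shared (All.tabulate redirect-shared)
    redirected : ∀ {ρ h D} → h ≡ inputs D ++ shared → substH ρ shared ≡ substH σ shared →
                 substH ρ h ≡ inputs (map ρ D) ++ substH σ shared
    redirected {ρ} {D = D} refl e = trans (substH-inputs-++ ρ D shared) (cong (inputs (map ρ D) ++_) e)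

  Aligned-redirect-swap : ∀ {F′} → Aligned (substH σ hG) (substH redirect hH) (substH redirect hR)
                                           (substP σ G) (substP redirect H) F′
  Aligned-redirect-swap = Aligned-swap (Aligned-redirect {[]}) map-redirect-A⊆

module Transfer (R : History → Proc 0 → Proc 0 → Set) (bisim : IsOpenBisim R) where
  open IsOpenBisim bisim
  open Redirect

  R-redirect : ∀ {hH hG hR H G F} (I : Aligned hH hG hR H G F) σ → Respects σ hG → R hR H G →
               R (substH (redirect I σ) hR) (substP (redirect I σ) H) (substP σ G)
  R-redirect I σ resp r =
    subst (R _ _) (substP-redirect-G I σ) (substR r (redirect I σ) (redirect-respects-hR I σ resp))

  BinderStep : (Name → Name → Act) → Tag → Set
  BinderStep act t = ∀ {h P Q P′ a x} → R h P Q → x ∉ fvP P → x ∉ fvP Q → x ∉ names h →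
                     P —[ act a x ]→ P′ → ∃ λ Q′ → (Q —[ act a x ]→ Q′) × R (h ∷ʳ (x , t)) P′ Q′

  BinderTarget : (Name → Name → Act) → Set
  BinderTarget act = ∀ {P x z P′} → P —[ act x z ]→ P′ → fvP P′ ⊆ z ∷ fvP P

  Transfers : Form n → (Nm n → Name) → Set
  Transfers φ v = ∀ {hH hG hR H G} → Aligned hH hG hR H G (fvF (just ∘ v) φ) → R hR H G →
                  Sat v hH H φ → Sat v hG G φ

  transfer-Dia : ∀ act t → BinderStep act t → BinderTarget act → ∀ a (φ : Form (suc n)) v →
                 (∀ z → Transfers φ (ext v z)) →
                 ∀ {hH hG hR H G} → Aligned hH hG hR H G (fvB v a φ) → R hR H G →
                 Dia act t v hH H a φ → Dia act t v hG G a φ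
  transfer-Dia act t step target a φ v body I r (z , (z∉H , z∉hH , z∉φ) , H′ , tH , s) =
    let (G′ , tG , r′) = step r z∉H (fresh-G I z∉hH) (fresh-hR I z∉hH) tH in
    z , (fresh-G I z∉hH , fresh-hG I z∉hH , z∉φ) , G′ , tG ,
    body z (Aligned-extend I z∉hH (target tH) (target tG) body-names) r′ s
    where
    body-names : fvF (just ∘ ext v z) φ ⊆ z ∷ fvB v a φ
    body-names q with fvF-ext φ v z q
    ... | here e  = here e
    ... | there p = there (there p)

  transfer-Box : ∀ act t → BinderStep act t → BinderTarget act → ∀ a (φ : Form (suc n)) v →
                 (∀ σ z → Transfers φ (ext (σ ∘ v) z)) →
                 ∀ {hH hG hR H G} → Aligned hH hG hR H G (fvB v a φ) → R hR H G →
                 Box act t v hH H a φ → Box act t v hG G a φ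
  transfer-Box act t step target a φ v body {hH} {hG} {hR} {H} {G} I r s σ resp z (z∉G , z∉hG , z∉φ) Q tG =
    let (H′ , tH , r′) = step (symm (R-redirect I σ resp r)) z∉G (fresh-G J z∉hG) (fresh-hR J z∉hG) tG in
    Sat-cong φ (Agree-ext a φ z ag)
      (body σ′ z (Aligned-extend (Aligned-redirect I σ) (fresh-hG J z∉hG) (target tH) (target tG) there)
        (symm r′)
        (s σ′ (redirect-respects-hH I σ resp) z
           (fresh-G J z∉hG , fresh-hG J z∉hG , λ q → z∉φ (fvB-cong a φ ag q))
           H′ (subst (λ x → substP σ′ H —[ act x z ]→ H′) (sym (ag a (inj₁ refl))) tH)))
    where
    σ′ : Subst
    σ′ = redirect I σ
    J : Aligned (substH σ hG) (substH σ′ hH) (substH σ′ hR) (substP σ G) (substP σ′ H) []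
    J = Aligned-redirect-swap I σ
    ag : AgreeB a φ (σ′ ∘ v) (σ ∘ v)
    ag = redirect-agree I σ (⟨bo⟩ a φ) v ⊆-refl

  transfer : ∀ (φ : Form n) v → Transfers φ v
  transfer tt v I r s = s
  transfer (φ ∧ ψ) v I r (s , s′) =
    transfer φ v (Aligned-mono I ⊆-refl ⊆-refl (xs⊆xs++ys _ _)) r s ,
    transfer ψ v (Aligned-mono I ⊆-refl ⊆-refl (xs⊆ys++xs _ _)) r s′
  transfer (φ ∨ ψ) v I r (inj₁ s) = inj₁ (transfer φ v (Aligned-mono I ⊆-refl ⊆-refl (xs⊆xs++ys _ _)) r s)
  transfer (φ ∨ ψ) v I r (inj₂ s) = inj₂ (transfer ψ v (Aligned-mono I ⊆-refl ⊆-refl (xs⊆ys++xs _ _)) r s)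
  transfer (φ ⊃ ψ) v {hH} {hG} {hR} {H} {G} I r s σ resp s₁ =
    Sat-cong ψ (λ c o → ag c (inj₂ o))
      (transfer ψ (σ′ ∘ v) (Aligned-redirect I σ) r′
        (s σ′ (redirect-respects-hH I σ resp)
          (Sat-cong φ (λ c o → sym (ag c (inj₁ o)))
            (transfer φ (σ ∘ v) (Aligned-redirect-swap I σ) (symm r′) s₁))))
    where
    σ′ : Subst
    σ′ = redirect I σ
    r′ : R (substH σ′ hR) (substP σ′ H) (substP σ G)
    r′ = R-redirect I σ resp r
    ag : Agree (φ ⊃ ψ) (σ′ ∘ v) (σ ∘ v)
    ag = redirect-agree I σ (φ ⊃ ψ) v ⊆-refl
  transfer (eqF a b) v I r e = e
  transfer (⟨τ⟩ φ) v I r (H′ , tH , s) =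
    let (G′ , tG , r′) = stepτ r tH in
    G′ , tG , transfer φ v (Aligned-mono I (fvP-target tH) (fvP-target tG) ⊆-refl) r′ s
  transfer ([τ] φ) v I r s σ resp Q tG =
    let (H′ , tH , r′) = stepτ (symm (R-redirect I σ resp r)) tG in
    Sat-cong φ (redirect-agree I σ φ v ⊆-refl)
      (transfer φ (σ′ ∘ v) (Aligned-mono (Aligned-redirect I σ) (fvP-target tH) (fvP-target tG) ⊆-refl)
        (symm r′) (s σ′ (redirect-respects-hH I σ resp) H′ tH))
    where
    σ′ : Subst
    σ′ = redirect I σ
  transfer (⟨fo⟩ a b φ) v I r (H′ , tH , s) =
    let (G′ , tG , r′) = stepFo r tH in
    G′ , tG , transfer φ v (Aligned-mono I (fvP-target tH) (fvP-target tG) (λ q → there (there q))) r′ s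
  transfer ([fo] a b φ) v {H = H} I r s σ resp Q tG =
    let (H′ , tH , r′) = stepFo (symm (R-redirect I σ resp r)) tG in
    Sat-cong φ (λ c o → ag c (inj₂ (inj₂ o)))
      (transfer φ (σ′ ∘ v) (Aligned-mono (Aligned-redirect I σ) (fvP-target tH) (fvP-target tG) ⊆-refl)
        (symm r′)
        (s σ′ (redirect-respects-hH I σ resp) H′
          (subst₂ (λ x y → substP σ′ H —[ fo x y ]→ H′)
                  (sym (ag a (inj₁ refl))) (sym (ag b (inj₂ (inj₁ refl)))) tH)))
    where
    σ′ : Subst
    σ′ = redirect I σ
    ag : Agree ([fo] a b φ) (σ′ ∘ v) (σ ∘ v)
    ag = redirect-agree I σ ([fo] a b φ) v ⊆-refl
  transfer (⟨bo⟩ a φ) v = transfer-Dia bo tO stepBo fvP-target a φ v (λ z → transfer φ (ext v z))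
  transfer (⟨ip⟩ a φ) v = transfer-Dia ip tI stepIp fvP-target a φ v (λ z → transfer φ (ext v z))
  transfer ([bo] a φ) v = transfer-Box bo tO stepBo fvP-target a φ v (λ σ z → transfer φ (ext (σ ∘ v) z))
  transfer ([ip] a φ) v = transfer-Box ip tI stepIp fvP-target a φ v (λ σ z → transfer φ (ext (σ ∘ v) z))

InputOnly : History → Set
InputOnly = All (λ p → proj₂ p ≡ tI)

InputOnly-inputs : ∀ xs → InputOnly (inputs xs)
InputOnly-inputs []       = []
InputOnly-inputs (x ∷ xs) = refl ∷ InputOnly-inputs xs

InputOnly-respects : ∀ {h} σ → InputOnly h → Respects σ h
InputOnly-respects σ o h′ x h″ refl with ++⁻ʳ h′ o
... | () ∷ _

Sat-nameless : ∀ (φ : Form n) {v h₁ h₂ P} → (∀ c → ¬ Occurs φ c) → InputOnly h₁ → InputOnly h₂ →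
               Sat v h₁ P φ → Sat v h₂ P φ
Sat-nameless tt           nl o₁ o₂ s        = s
Sat-nameless (φ ∧ ψ)      nl o₁ o₂ (s , s′) =
  Sat-nameless φ (λ c → nl c ∘ inj₁) o₁ o₂ s , Sat-nameless ψ (λ c → nl c ∘ inj₂) o₁ o₂ s′
Sat-nameless (φ ∨ ψ)      nl o₁ o₂ (inj₁ s) = inj₁ (Sat-nameless φ (λ c → nl c ∘ inj₁) o₁ o₂ s)
Sat-nameless (φ ∨ ψ)      nl o₁ o₂ (inj₂ s) = inj₂ (Sat-nameless ψ (λ c → nl c ∘ inj₂) o₁ o₂ s)
Sat-nameless (φ ⊃ ψ)      nl o₁ o₂ s σ _ s₁ =
  Sat-nameless ψ (λ c → nl c ∘ inj₂) (All-map⁺ o₁) (All-map⁺ o₂)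
    (s σ (InputOnly-respects σ o₁) (Sat-nameless φ (λ c → nl c ∘ inj₁) (All-map⁺ o₂) (All-map⁺ o₁) s₁))
Sat-nameless (eqF a b)    nl o₁ o₂ e        = e
Sat-nameless (⟨τ⟩ φ)      nl o₁ o₂ (Q , t , s) = Q , t , Sat-nameless φ nl o₁ o₂ s
Sat-nameless ([τ] φ)      nl o₁ o₂ s σ _ Q t =
  Sat-nameless φ nl (All-map⁺ o₁) (All-map⁺ o₂) (s σ (InputOnly-respects σ o₁) Q t)
Sat-nameless (⟨fo⟩ a b φ) nl _ _ _ = ⊥-elim (nl a (inj₁ refl))
Sat-nameless ([fo] a b φ) nl _ _ _ = ⊥-elim (nl a (inj₁ refl))
Sat-nameless (⟨bo⟩ a φ)   nl _ _ _ = ⊥-elim (nl a (inj₁ refl))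
Sat-nameless ([bo] a φ)   nl _ _ _ = ⊥-elim (nl a (inj₁ refl))
Sat-nameless (⟨ip⟩ a φ)   nl _ _ _ = ⊥-elim (nl a (inj₁ refl))
Sat-nameless ([ip] a φ)   nl _ _ _ = ⊥-elim (nl a (inj₁ refl))

⊆-names-inputs : ∀ {L} D → L ⊆ D → L ⊆ names (inputs D)
⊆-names-inputs D s q = subst (_ ∈_) (sym (names-inputs D)) (s q)

open Transfer using (transfer)

module _ {P Q : Proc 0} {xs₀ : List Name} {R : History → Proc 0 → Proc 0 → Set}
         (bisim : IsOpenBisim R) (r : R (inputs xs₀) P Q) (fvP⊆ : fvP P ⊆ xs₀)
         (φ : Form 0) (P⊨φ : P ⊨ φ) where

  Sat-pivoted : ∀ xs {b} → b ∈ xs → fvP Q ⊆ xs → fvForm φ ⊆ xs → Sat val (inputs xs) Q φ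
  Sat-pivoted xs {b} b∈xs fvQ⊆ fvφ⊆ =
    transfer R bisim φ val start r (P⊨φ (xs ++ xs₀) (λ q → ∈-++⁺ʳ xs (fvP⊆ q)) (λ q → ∈-++⁺ˡ (fvφ⊆ q)))
    where
    start : Aligned (inputs (xs ++ xs₀)) (inputs xs) (inputs xs₀) P Q (fvForm φ)
    start = aligned (xs ++ xs₀) xs xs₀ [] b
      (sym (++-identityʳ _)) (sym (++-identityʳ _)) (sym (++-identityʳ _))
      b∈xs (xs⊆xs++ys xs xs₀) (xs⊆ys++xs xs₀ xs)
      (λ _ y∉xs → (λ ()) , (λ q → y∉xs (fvQ⊆ q)) , (λ q → y∉xs (fvφ⊆ q)))
      (⊆-names-inputs (xs ++ xs₀) (λ q → ∈-++⁺ʳ xs (fvP⊆ q))) (⊆-names-inputs xs fvQ⊆)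

  -- Without names there is no pivot; borrow the name 0, which cannot matter for a nameless φ.
  ⊨-transfer : Q ⊨ φ
  ⊨-transfer []       fvQ⊆ fvφ⊆ =
    Sat-nameless φ nameless (InputOnly-inputs [ 0 ]) (InputOnly-inputs [])
      (Sat-pivoted [ 0 ] (here refl) (⊆-trans fvQ⊆ λ ()) (⊆-trans fvφ⊆ λ ()))
    where
    nameless : ∀ c → ¬ Occurs φ c
    nameless (fr x) o with fvφ⊆ (Occurs⇒∈fvF φ (just ∘ val) o refl)
    ... | ()
  ⊨-transfer (b ∷ xs) fvQ⊆ fvφ⊆ = Sat-pivoted (b ∷ xs) (here refl) fvQ⊆ fvφ⊆

theorem1 : ∀ (P Q : Proc 0) → P ∼ Q → ∀ (φ : Form 0) →
             (P ⊨ φ → Q ⊨ φ) × (Q ⊨ φ → P ⊨ φ)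
theorem1 P Q (xs₀ , fvP⊆ , fvQ⊆ , R , bisim , r) φ =
  ⊨-transfer bisim r fvP⊆ φ , ⊨-transfer bisim (IsOpenBisim.symm bisim r) fvQ⊆ φ
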